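{- Let $(U,E)$ be a univalent universe, let $\mathcal{A}$ be a reflexive graph and let $\mathcal{B}$ be a $U$-small covariant fibration of reflexive graphs over $\mathcal{A}$. Let $\mathcal{D}$ be the display of the underlying oplax covariant lens of $\mathcal{B}$ (defined below). Then there is an equivalence of displayed reflexive graphs over $\mathcal{A}$ from $\mathcal{B}$ to $\mathcal{D}$.
   Context: Intensional Martin-Löf type theory with $\Pi,\Sigma$, identity types. $(U,E)$ univalent: $(A=_UB)\to\mathsf{Equiv}(E A,E B)$ is an equivalence for all $A,B$. A reflexive graph $\mathcal{G}$: type $|\mathcal{G}|$, edge types $x\approx_{\mathcal{G}}y$, $\mathsf{rx}_{\mathcal{G}}(x):x\approx_{\mathcal{G}}x$. A displayed reflexive graph $\mathcal{B}$ over $\mathcal{A}$: types $|\mathcal{B}|(x)$, types $u\approx^{\mathcal{B}}_pv$ for $p:x\approx_{\mathcal{A}}y$, $u:|\mathcal{B}|(x)$, $v:|\mathcal{B}|(y)$, and $\mathsf{rx}^{\mathcal{B}}_x(u):u\approx^{\mathcal{B}}_{\mathsf{rx}_{\mathcal{A}}(x)}u$; it is $U$-small if these types lie in $U$. Its component $\mathcal{B}(x)$ is the reflexive graph with vertices $|\mathcal{B}|(x)$, edges $u\approx^{\mathcal{B}}_{\mathsf{rx}_{\mathcal{A}}(x)}v$, reflexivity $\mathsf{rx}^{\mathcal{B}}_x$. $\mathcal{B}$ is a covariant fibration if each $\sum_{v:|\mathcal{B}|(y)}u\approx^{\mathcal{B}}_pv$ is contractible; write $(p_*u,p_\dagger u)$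 for its centre. Straightening: for $q:u\approx^{\mathcal{B}}_pv$, choose an identification $H:(p_*u,p_\dagger u)=(v,q)$ in that contractible type and let $\mathsf{str}_p(q):p_*u\approx_{\mathcal{B}(y)}v$ be the transport of $\mathsf{rx}^{\mathcal{B}}_y(p_*u)$ along $H$ in the family $(w,r)\mapsto p_*u\approx_{\mathcal{B}(y)}w$. The underlying oplax covariant lens of $\mathcal{B}$ is the family of components $\mathcal{B}(x)$ with pushforward $\mathsf{push}_pu:=p_*u$ and unitor $\mathsf{pushRx}_x(u):=\mathsf{str}_{\mathsf{rx}_{\mathcal{A}}(x)}(\mathsf{rx}^{\mathcal{B}}_x(u)):\mathsf{push}_{\mathsf{rx}_{\mathcal{A}}(x)}u\approx_{\mathcal{B}(x)}u$. For an oplax covariant lens $\mathcal{C}$ (family of reflexive graphs $\mathcal{C}(x)$ with $\mathsf{push}_p:|\mathcal{C}(x)|\to|\mathcal{C}(y)|$ and $\mathsf{pushRx}_x(u):\mathsf{push}_{\mathsf{rx}(x)}u\approx_{\mathcal{C}(x)}u$), its display is the displayed reflexive graph with vertices $|\mathcal{C}(x)|$, edges $u\approx_pv:=\mathsf{push}_pu\approx_{\mathcal{C}(y)}v$ and reflexivity $\mathsf{pushRx}_x(u)$. An equivalence of displayed reflexive graphs $\mathcal{B}_0\to\mathcal{B}_1$ over $\mathcal{A}$ consists of equivalences $f_x:|\mathcal{B}_0|(x)\simeq|\mathcal{B}_1|(x)$, equivalences $f^{\approx}:(u\approx^{\mathcal{B}_0}_pv)\simeq(f_xu\approx^{\mathcal{B}_1}_pf_yv)$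 for all $p:x\approx_{\mathcal{A}}y$, $u,v$, and identifications $f^{\approx}(\mathsf{rx}^{\mathcal{B}_0}_x(u))=\mathsf{rx}^{\mathcal{B}_1}_x(f_xu)$. -}

{-# OPTIONS --without-K #-}
module Defs where

open import Level using (Level; _⊔_; suc)
open import Data.Product using (Σ; _,_; proj₁; proj₂; Σ-syntax)
open import Relation.Binary.PropositionalEquality using (_≡_; refl; sym; trans; subst)

isContr : ∀ {a} → Set a → Set a
isContr A = Σ A (λ c → (x : A) → c ≡ x)

fiber : ∀ {a b} {A : Set a} {B : Set b} → (A → B) → B → Set (a ⊔ b)
fiber {A = A} f y = Σ A (λ x → f x ≡ y)

isEquiv : ∀ {a b} {A : Set a} {B : Set b} → (A → B) → Set (a ⊔ b)
isEquiv {B = B} f = (y : B) → isContr (fiber f y)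

Equiv : ∀ {a b} → Set a → Set b → Set (a ⊔ b)
Equiv A B = Σ (A → B) isEquiv

idIsEquiv : ∀ {a} (A : Set a) → isEquiv (λ (x : A) → x)
idIsEquiv A y = (y , refl) , λ { (x , refl) → refl }

idEquiv : ∀ {a} (A : Set a) → Equiv A A
idEquiv A = (λ x → x) , idIsEquiv A

idToEquiv : ∀ {u e} {U : Set u} (E : U → Set e) (A B : U) → A ≡ B → Equiv (E A) (E B)
idToEquiv E A .A refl = idEquiv (E A)

isUnivalent : ∀ {u e} (U : Set u) (E : U → Set e) → Set (u ⊔ e)
isUnivalent U E = (A B : U) → isEquiv (idToEquiv E A B)

record ReflGraph (i j : Level) : Set (suc (i ⊔ j)) where
  field
    vert : Set i
    edge : vert → vert → Set j
    rx   : (x : vert) → edge x x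
open ReflGraph public

record DispReflGraph {i j} (𝒜 : ReflGraph i j) (k l : Level) : Set (i ⊔ j ⊔ suc (k ⊔ l)) where
  field
    dvert : vert 𝒜 → Set k
    dedge : {x y : vert 𝒜} → edge 𝒜 x y → dvert x → dvert y → Set l
    drx   : (x : vert 𝒜) (u : dvert x) → dedge (rx 𝒜 x) u u
open DispReflGraph public

record USmallDispReflGraph {i j u e} (𝒜 : ReflGraph i j) (U : Set u) (E : U → Set e)
       : Set (i ⊔ j ⊔ u ⊔ e) where
  field
    vertCode : vert 𝒜 → U
    edgeCode : {x y : vert 𝒜} → edge 𝒜 x y → E (vertCode x) → E (vertCode y) → U
    rxCode   : (x : vert 𝒜) (v : E (vertCode x)) → E (edgeCode (rx 𝒜 x) v v)
open USmallDispReflGraph public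

El : ∀ {i j u e} {𝒜 : ReflGraph i j} {U : Set u} {E : U → Set e}
     → USmallDispReflGraph 𝒜 U E → DispReflGraph 𝒜 e e
El {E = E} ℬ = record
  { dvert = λ x → E (vertCode ℬ x)
  ; dedge = λ p u v → E (edgeCode ℬ p u v)
  ; drx   = rxCode ℬ
  }

component : ∀ {i j k l} {𝒜 : ReflGraph i j} → DispReflGraph 𝒜 k l → vert 𝒜 → ReflGraph k l
component {𝒜 = 𝒜} ℬ x = record
  { vert = dvert ℬ x
  ; edge = λ u v → dedge ℬ (rx 𝒜 x) u v
  ; rx   = drx ℬ x
  }

isCovariantFibration : ∀ {i j k l} {𝒜 : ReflGraph i j} → DispReflGraph 𝒜 k l → Set (i ⊔ j ⊔ k ⊔ l)
isCovariantFibration {𝒜 = 𝒜} ℬ =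
  {x y : vert 𝒜} (p : edge 𝒜 x y) (u : dvert ℬ x) → isContr (Σ[ v ∈ dvert ℬ y ] dedge ℬ p u v)

module _ {i j k l} {𝒜 : ReflGraph i j} (ℬ : DispReflGraph 𝒜 k l) (fib : isCovariantFibration ℬ) where

  pushF : {x y : vert 𝒜} → edge 𝒜 x y → dvert ℬ x → dvert ℬ y
  pushF p u = proj₁ (proj₁ (fib p u))

  liftF : {x y : vert 𝒜} (p : edge 𝒜 x y) (u : dvert ℬ x) → dedge ℬ p u (pushF p u)
  liftF p u = proj₂ (proj₁ (fib p u))

  str : {x y : vert 𝒜} (p : edge 𝒜 x y) {u : dvert ℬ x} {v : dvert ℬ y}
        → dedge ℬ p u v → dedge ℬ (rx 𝒜 y) (pushF p u) v
  str {y = y} p {u} {v} q =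
    subst (λ (wr : Σ[ w ∈ dvert ℬ y ] dedge ℬ p u w) → dedge ℬ (rx 𝒜 y) (pushF p u) (proj₁ wr))
          H (drx ℬ y (pushF p u))
    where
      c = fib p u
      H : (pushF p u , liftF p u) ≡ (v , q)
      H = trans (sym (proj₂ c (proj₁ c))) (proj₂ c (v , q))

record OplaxCovLens {i j} (𝒜 : ReflGraph i j) (k l : Level) : Set (i ⊔ j ⊔ suc (k ⊔ l)) where
  field
    comp   : vert 𝒜 → ReflGraph k l
    push   : {x y : vert 𝒜} → edge 𝒜 x y → vert (comp x) → vert (comp y)
    pushRx : (x : vert 𝒜) (u : vert (comp x)) → edge (comp x) (push (rx 𝒜 x) u) u
open OplaxCovLens public

underlyingLens : ∀ {i j k l} {𝒜 : ReflGraph i j} (ℬ : DispReflGraph 𝒜 k l)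
                 → isCovariantFibration ℬ → OplaxCovLens 𝒜 k l
underlyingLens {𝒜 = 𝒜} ℬ fib = record
  { comp   = component ℬ
  ; push   = pushF ℬ fib
  ; pushRx = λ x u → str ℬ fib (rx 𝒜 x) (drx ℬ x u)
  }

display : ∀ {i j k l} {𝒜 : ReflGraph i j} → OplaxCovLens 𝒜 k l → DispReflGraph 𝒜 k l
display {𝒜 = 𝒜} 𝒞 = record
  { dvert = λ x → vert (comp 𝒞 x)
  ; dedge = λ {x} {y} p u v → edge (comp 𝒞 y) (push 𝒞 p u) v
  ; drx   = pushRx 𝒞
  }

record DispEquiv {i j k l k' l'} {𝒜 : ReflGraph i j}
       (ℬ₀ : DispReflGraph 𝒜 k l) (ℬ₁ : DispReflGraph 𝒜 k' l')
       : Set (i ⊔ j ⊔ k ⊔ l ⊔ k' ⊔ l') where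
  field
    f    : (x : vert 𝒜) → Equiv (dvert ℬ₀ x) (dvert ℬ₁ x)
    f≈   : {x y : vert 𝒜} (p : edge 𝒜 x y) (u : dvert ℬ₀ x) (v : dvert ℬ₀ y)
           → Equiv (dedge ℬ₀ p u v) (dedge ℬ₁ p (proj₁ (f x) u) (proj₁ (f y) v))
    f-rx : (x : vert 𝒜) (u : dvert ℬ₀ x)
           → proj₁ (f≈ (rx 𝒜 x) u u) (drx ℬ₀ x u) ≡ drx ℬ₁ x (proj₁ (f x) u)

{-# OPTIONS --without-K #-}
-- Straightening str p : (u ≈_p v) → (p_* u ≈_{rx y} v) is a family of maps indexed by v
-- whose total spaces Σ v (u ≈_p v) and Σ v (p_* u ≈_{rx y} v) are both contractible by the
-- fibration property, so it is a fibrewise equivalence.  Together with the identity on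
-- vertices this is the required equivalence; it preserves reflexivity definitionally, because
-- the unitor of the underlying lens is str applied to reflexivity.
module Submission where

open import Defs
open import Data.Product using (Σ; _,_; proj₁; proj₂)
open import Relation.Binary.PropositionalEquality using (_≡_; refl; sym; trans; cong)
open import Relation.Binary.PropositionalEquality.Properties using (trans-symˡ)

isContr-≡ : ∀ {a} {A : Set a} → isContr A → (x y : A) → isContr (x ≡ y)
isContr-≡ (c , contract) x y = trans (sym (contract x)) (contract y) , λ { refl → trans-symˡ (contract x) }

isContr-Σ : ∀ {a b} {A : Set a} {B : A → Set b}
            → isContr A → ((x : A) → isContr (B x)) → isContr (Σ A B)
isContr-Σ {B = B} (c , contract) isContr-B = (c , centre-B) , λ { (x , b) → to (contract x) b }
  where
    centre-B : B c
    centre-B = proj₁ (isContr-B c)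

    to : ∀ {x} (e : c ≡ x) (b : B x) → (c , centre-B) ≡ (x , b)
    to refl b = cong (c ,_) (proj₂ (isContr-B c) b)

isContr-retract : ∀ {a b} {A : Set a} {B : Set b} (r : B → A) (s : A → B)
                  → ((x : A) → r (s x) ≡ x) → isContr B → isContr A
isContr-retract r s r∘s≡id (c , contract) = r c , λ x → trans (cong r (contract (s x))) (r∘s≡id x)

module _ {a b c} {V : Set a} {P : V → Set b} {Q : V → Set c} (f : (w : V) → P w → Q w) where

  total : Σ V P → Σ V Q
  total (w , x) = w , f w x

  private
    fiber-total→fiber : ∀ {w y} → fiber total (w , y) → fiber (f w) y
    fiber-total→fiber ((_ , x) , refl) = x , refl

    fiber→fiber-total : ∀ {w y} → fiber (f w) y → fiber total (w , y)
    fiber→fiber-total {w} (x , e) = (w , x) , cong (w ,_) e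

    fiber-retract : ∀ {w y} (z : fiber (f w) y) → fiber-total→fiber (fiber→fiber-total z) ≡ z
    fiber-retract (_ , refl) = refl

  fiberwise-isEquiv-of-isContr-Σ : isContr (Σ V P) → isContr (Σ V Q) → (w : V) → isEquiv (f w)
  fiberwise-isEquiv-of-isContr-Σ isContr-ΣP isContr-ΣQ w y =
    isContr-retract fiber-total→fiber fiber→fiber-total fiber-retract
      (isContr-Σ isContr-ΣP (λ t → isContr-≡ isContr-ΣQ (total t) (w , y)))

module _ {i j k l} {𝒜 : ReflGraph i j} (ℬ : DispReflGraph 𝒜 k l) (fib : isCovariantFibration ℬ) where

  str-isEquiv : {x y : vert 𝒜} (p : edge 𝒜 x y) (u : dvert ℬ x) (v : dvert ℬ y)
                → isEquiv (str ℬ fib p {u} {v})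
  str-isEquiv {y = y} p u =
    fiberwise-isEquiv-of-isContr-Σ (λ v → str ℬ fib p {u} {v})
      (fib p u) (fib (rx 𝒜 y) (pushF ℬ fib p u))

  covariantFibration≃display : DispEquiv ℬ (display (underlyingLens ℬ fib))
  covariantFibration≃display = record
    { f    = λ x → idEquiv (dvert ℬ x)
    ; f≈   = λ p u v → str ℬ fib p , str-isEquiv p u v
    ; f-rx = λ x u → refl
    }

mainTheorem2 : ∀ {u e i j} (U : Set u) (E : U → Set e) → isUnivalent U E
    → (𝒜 : ReflGraph i j) (ℬ : USmallDispReflGraph 𝒜 U E) (fib : isCovariantFibration (El ℬ))
    → DispEquiv (El ℬ) (display (underlyingLens (El ℬ) fib))
mainTheorem2 U E _ 𝒜 ℬ fib = covariantFibration≃display (El ℬ) fib
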